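{- Let $\mathbf{u}$ be a $1$-balanced sequence over the alphabet $\{a,b\}$, let $\mathbf{a}=1^{\omega}$ be the constant sequence over $\{1\}$, and let $\mathbf{b}=b_0b_1b_2\cdots$ be a $1$-balanced sequence over the alphabet $\{2,3\}$. Then the ternary sequence $\mathbf{v}=\mathrm{colour}(\mathbf{u},\mathbf{a},\mathbf{b})$ is $2$-balanced.
   Context: A sequence $\mathbf{w}$ over an alphabet $\mathcal A$ is $C$-balanced (for an integer $C\ge 1$) if for any two factors (finite contiguous blocks) $u,v$ of $\mathbf{w}$ with $|u|=|v|$ and every letter $c\in\mathcal A$ we have $\bigl||u|_c-|v|_c\bigr|\le C$, where $|u|_c$ is the number of occurrences of $c$ in $u$. Colouring: given a sequence $\mathbf{u}$ over $\{a,b\}$ and sequences $\mathbf{a},\mathbf{b}$ over mutually disjoint alphabets $\mathcal A,\mathcal B$, the sequence $\mathrm{colour}(\mathbf{u},\mathbf{a},\mathbf{b})$ over $\mathcal A\cup\mathcal B$ is obtained from $\mathbf{u}$ by replacing the subsequence of all occurrences of $a$ (in order) by the successive letters of $\mathbf{a}$, and the subsequence of all occurrences of $b$ (in order) by the successive letters of $\mathbf{b}$. -}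

module Defs where

open import Data.Nat using (ℕ; zero; suc; _+_; _≤_)
open import Data.Bool using (Bool; true; false; if_then_else_)
open import Relation.Nullary using (Dec; yes; no)
open import Relation.Binary.PropositionalEquality using (_≡_)
open import Relation.Binary.Definitions using (DecidableEquality)

Seq : Set → Set
Seq A = ℕ → A

count : {A : Set} → DecidableEquality A → Seq A → A → ℕ → ℕ → ℕ
count _≟_ w c i zero = 0
count _≟_ w c i (suc n) with w i ≟ c
... | yes _ = suc (count _≟_ w c (suc i) n)
... | no _  = count _≟_ w c (suc i) n

-- C-balanced: for all factors u = w[i..i+n), v = w[j..j+n) and all letters c,
-- | |u|_c - |v|_c | ≤ C   (written as two inequalities over ℕ)
Balanced : {A : Set} → DecidableEquality A → ℕ → Seq A → Set
Balanced _≟_ C w = ∀ (c : _) (i j n : ℕ) →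
  count _≟_ w c i n ≤ count _≟_ w c j n + C

data AB : Set where
  a b : AB

_≟AB_ : DecidableEquality AB
a ≟AB a = yes Relation.Binary.PropositionalEquality.refl
a ≟AB b = no (λ ())
b ≟AB a = no (λ ())
b ≟AB b = yes Relation.Binary.PropositionalEquality.refl

data One : Set where
  one : One

data TwoThree : Set where
  two three : TwoThree

_≟23_ : DecidableEquality TwoThree
two ≟23 two = yes Relation.Binary.PropositionalEquality.refl
two ≟23 three = no (λ ())
three ≟23 two = no (λ ())
three ≟23 three = yes Relation.Binary.PropositionalEquality.refl

data Ter : Set where
  t1 t2 t3 : Ter

_≟T_ : DecidableEquality Ter
t1 ≟T t1 = yes Relation.Binary.PropositionalEquality.refl
t1 ≟T t2 = no (λ ())
t1 ≟T t3 = no (λ ())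
t2 ≟T t1 = no (λ ())
t2 ≟T t2 = yes Relation.Binary.PropositionalEquality.refl
t2 ≟T t3 = no (λ ())
t3 ≟T t1 = no (λ ())
t3 ≟T t2 = no (λ ())
t3 ≟T t3 = yes Relation.Binary.PropositionalEquality.refl

inj1 : One → Ter
inj1 one = t1

inj23 : TwoThree → Ter
inj23 two = t2
inj23 three = t3

colour : Seq AB → Seq One → Seq TwoThree → Seq Ter
colour u x y n with u n
... | a = inj1 (x (count _≟AB_ u a 0 n))
... | b = inj23 (y (count _≟AB_ u b 0 n))

{-# OPTIONS --safe #-}
module Submission where

-- The letter 1 occurs in a factor of v = colour(u, 1^ω, y) exactly as often as a does in the
-- factor of u at the same place. The letters 2 and 3 of a factor of v spell out a factor of y
-- whose length is the number of b's in the corresponding factor of u; by 1-balancedness of u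
-- two such lengths differ by at most 1, and a length difference of k can add at most k
-- occurrences on top of the balance constant 1 of y.

open import Defs
open import Data.Nat
open import Data.Nat.Properties
open import Relation.Nullary using (yes; no)
open import Relation.Binary.PropositionalEquality
open import Relation.Binary.Definitions using (DecidableEquality)

occ : {A : Set} → DecidableEquality A → A → A → ℕ
occ _≟_ x c with x ≟ c
... | yes _ = 1
... | no _  = 0

module _ {A : Set} (_≟_ : DecidableEquality A) (w : Seq A) (c : A) where

  count-suc : ∀ i n → count _≟_ w c i (suc n) ≡ occ _≟_ (w i) c + count _≟_ w c (suc i) n
  count-suc i n with w i ≟ c
  ... | yes _ = refl
  ... | no _  = refl

  count-+ : ∀ i m n → count _≟_ w c i (m + n) ≡ count _≟_ w c i m + count _≟_ w c (i + m) n
  count-+ i zero    n rewrite +-identityʳ i = refl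
  count-+ i (suc m) n rewrite +-suc i m with w i ≟ c
  ... | yes _ = cong suc (count-+ (suc i) m n)
  ... | no _  = count-+ (suc i) m n

  count-snoc : ∀ i m → count _≟_ w c i (suc m) ≡ occ _≟_ (w (i + m)) c + count _≟_ w c i m
  count-snoc i m = begin
    count _≟_ w c i (suc m)                            ≡⟨ cong (count _≟_ w c i) (+-comm 1 m) ⟩
    count _≟_ w c i (m + 1)                            ≡⟨ count-+ i m 1 ⟩
    count _≟_ w c i m + count _≟_ w c (i + m) 1        ≡⟨ cong (count _≟_ w c i m +_) (count-suc (i + m) 0) ⟩
    count _≟_ w c i m + (occ _≟_ (w (i + m)) c + 0)    ≡⟨ cong (count _≟_ w c i m +_) (+-identityʳ _) ⟩
    count _≟_ w c i m + occ _≟_ (w (i + m)) c          ≡⟨ +-comm (count _≟_ w c i m) _ ⟩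
    occ _≟_ (w (i + m)) c + count _≟_ w c i m          ∎
    where open ≡-Reasoning

  count≤length : ∀ i n → count _≟_ w c i n ≤ n
  count≤length i zero = z≤n
  count≤length i (suc n) with w i ≟ c
  ... | yes _ = s≤s (count≤length (suc i) n)
  ... | no _  = m≤n⇒m≤1+n (count≤length (suc i) n)

  count-mono : ∀ i {m n} → m ≤ n → count _≟_ w c i m ≤ count _≟_ w c i n
  count-mono i {m} {n} m≤n = begin
    count _≟_ w c i m                                      ≤⟨ m≤m+n _ _ ⟩
    count _≟_ w c i m + count _≟_ w c (i + m) (n ∸ m)      ≡⟨ count-+ i m (n ∸ m) ⟨
    count _≟_ w c i (m + (n ∸ m))                          ≡⟨ cong (count _≟_ w c i) (m+[n∸m]≡n m≤n) ⟩
    count _≟_ w c i n                                      ∎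
    where open ≤-Reasoning

balanced-unequal-lengths : {A : Set} {_≟_ : DecidableEquality A} {C : ℕ} {w : Seq A} →
  Balanced _≟_ C w → ∀ c p q {m m′} k → m ≤ m′ + k →
  count _≟_ w c p m ≤ count _≟_ w c q m′ + (C + k)
balanced-unequal-lengths {_≟_ = _≟_} {C} {w} bal c p q {m} {m′} k m≤m′+k = begin
  count _≟_ w c p m                                       ≤⟨ count-mono _≟_ w c p (m≤n+m∸n m m′) ⟩
  count _≟_ w c p (m′ + r)                                ≡⟨ count-+ _≟_ w c p m′ r ⟩
  count _≟_ w c p m′ + count _≟_ w c (p + m′) r           ≤⟨ +-mono-≤ (bal c p q m′) (count≤length _≟_ w c (p + m′) r) ⟩
  count _≟_ w c q m′ + C + r                              ≤⟨ +-monoʳ-≤ _ (m≤n+o⇒m∸n≤o m m′ m≤m′+k) ⟩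
  count _≟_ w c q m′ + C + k                              ≡⟨ +-assoc _ C k ⟩
  count _≟_ w c q m′ + (C + k)                            ∎
  where
  open ≤-Reasoning
  r : ℕ
  r = m ∸ m′

occ-inj23 : ∀ z c → occ _≟T_ (inj23 z) (inj23 c) ≡ occ _≟23_ z c
occ-inj23 two   two   = refl
occ-inj23 two   three = refl
occ-inj23 three two   = refl
occ-inj23 three three = refl

module _ (u : Seq AB) (x : Seq One) (y : Seq TwoThree) where

  private
    v : Seq Ter
    v = colour u x y

    #b : ℕ → ℕ → ℕ
    #b = count _≟AB_ u b

  occ-colour-t1 : ∀ i → occ _≟T_ (v i) t1 ≡ occ _≟AB_ (u i) a
  occ-colour-t1 i with u i
  ... | a with x (count _≟AB_ u a 0 i)
  ...   | one = refl
  occ-colour-t1 i | b with y (#b 0 i)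
  ...   | two   = refl
  ...   | three = refl

  -- Position i of v consumes a letter of y exactly when u i = b.
  occ-colour-inj23 : ∀ c i m →
    occ _≟T_ (v i) (inj23 c) + count _≟23_ y c (occ _≟AB_ (u i) b + #b 0 i) m ≡
    count _≟23_ y c (#b 0 i) (occ _≟AB_ (u i) b + m)
  occ-colour-inj23 c i m with u i
  ... | a with x (count _≟AB_ u a 0 i) | c
  ...   | one | two   = refl
  ...   | one | three = refl
  occ-colour-inj23 c i m | b =
    trans (cong (_+ count _≟23_ y c (suc (#b 0 i)) m) (occ-inj23 (y (#b 0 i)) c))
          (sym (count-suc _≟23_ y c (#b 0 i) m))

  count-colour-t1 : ∀ i n → count _≟T_ v t1 i n ≡ count _≟AB_ u a i n
  count-colour-t1 i zero    = refl
  count-colour-t1 i (suc n) = begin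
    count _≟T_ v t1 i (suc n)                              ≡⟨ count-suc _≟T_ v t1 i n ⟩
    occ _≟T_ (v i) t1 + count _≟T_ v t1 (suc i) n          ≡⟨ cong₂ _+_ (occ-colour-t1 i) (count-colour-t1 (suc i) n) ⟩
    occ _≟AB_ (u i) a + count _≟AB_ u a (suc i) n          ≡⟨ count-suc _≟AB_ u a i n ⟨
    count _≟AB_ u a i (suc n)                              ∎
    where open ≡-Reasoning

  count-colour-inj23 : ∀ c i n → count _≟T_ v (inj23 c) i n ≡ count _≟23_ y c (#b 0 i) (#b i n)
  count-colour-inj23 c i zero    = refl
  count-colour-inj23 c i (suc n) = begin
    count _≟T_ v (inj23 c) i (suc n)
      ≡⟨ count-suc _≟T_ v (inj23 c) i n ⟩
    occ _≟T_ (v i) (inj23 c) + count _≟T_ v (inj23 c) (suc i) n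
      ≡⟨ cong (occ _≟T_ (v i) (inj23 c) +_) (count-colour-inj23 c (suc i) n) ⟩
    occ _≟T_ (v i) (inj23 c) + count _≟23_ y c (#b 0 (suc i)) (#b (suc i) n)
      ≡⟨ cong (λ p → occ _≟T_ (v i) (inj23 c) + count _≟23_ y c p (#b (suc i) n)) (count-snoc _≟AB_ u b 0 i) ⟩
    occ _≟T_ (v i) (inj23 c) + count _≟23_ y c (occ _≟AB_ (u i) b + #b 0 i) (#b (suc i) n)
      ≡⟨ occ-colour-inj23 c i (#b (suc i) n) ⟩
    count _≟23_ y c (#b 0 i) (occ _≟AB_ (u i) b + #b (suc i) n)
      ≡⟨ cong (count _≟23_ y c (#b 0 i)) (count-suc _≟AB_ u b i n) ⟨
    count _≟23_ y c (#b 0 i) (#b i (suc n))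
      ∎
    where open ≡-Reasoning

  colour-balanced-t1 : ∀ {C} → Balanced _≟AB_ C u → ∀ i j n →
    count _≟T_ v t1 i n ≤ count _≟T_ v t1 j n + C
  colour-balanced-t1 bal-u i j n
    rewrite count-colour-t1 i n | count-colour-t1 j n = bal-u a i j n

  colour-balanced-inj23 : ∀ {C D} → Balanced _≟AB_ C u → Balanced _≟23_ D y → ∀ c i j n →
    count _≟T_ v (inj23 c) i n ≤ count _≟T_ v (inj23 c) j n + (D + C)
  colour-balanced-inj23 {C} bal-u bal-y c i j n
    rewrite count-colour-inj23 c i n | count-colour-inj23 c j n =
    balanced-unequal-lengths bal-y c (#b 0 i) (#b 0 j) C (bal-u b i j n)

lemma1 : (u : Seq AB) (y : Seq TwoThree) →
    Balanced _≟AB_ 1 u → Balanced _≟23_ 1 y →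
    Balanced _≟T_ 2 (colour u (λ _ → one) y)
lemma1 u y bal-u bal-y t1 i j n =
  ≤-trans (colour-balanced-t1 u _ y bal-u i j n) (+-monoʳ-≤ _ (n≤1+n 1))
lemma1 u y bal-u bal-y t2 = colour-balanced-inj23 u _ y bal-u bal-y two
lemma1 u y bal-u bal-y t3 = colour-balanced-inj23 u _ y bal-u bal-y three
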